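{- Let $n \in \mathbb{N}$, let $\mathcal{F}$ be a family of subsets of $[n]$ with $|\mathcal{F}| = n$ that satisfies the marriage condition, and let $t$ be a transversal of $\mathcal{F}$. Let $S \subseteq [n]$ be the set of elements $k\in[n]$ such that $k \in F$ for exactly one member $F$ of $\mathcal{F}$, and let $m$ be an integer with $\min(n, n-|S|+1) \le m \le n$. Then $\mathcal{F}$ is shellable if and only if for every configuration $f$ of $t$ there exists a surjective map $\sigma:[n]\to[m]$ that satisfies $f$.
   Context: $\mathbb{N}$ denotes the positive integers and $[n]=\{1,\dots,n\}$. Families of sets are treated as multisets (members counted with multiplicity). A family $\mathcal{F}$ of subsets of $[n]$ satisfies the marriage condition if for every subfamily $\mathcal{F}'\subseteq\mathcal{F}$, $|\mathcal{F}'| \le \left|\bigcup_{F\in\mathcal{F}'}F\right|$. A transversal of $\mathcal{F}$ is an injective map $t:\mathcal{F}\to[n]$ (assigning to each member, counted with multiplicity, an element) with $t(F)\in F$ for all $F\in\mathcal{F}$. A configuration of $t$ is a function $f:[n]\to\mathbb{N}$ such that $f(t(F)) \le |F|$ for all $F\in\mathcal{F}$. For $m\le n$, a surjective map $\sigma:[n]\to[m]$ satisfies $f$ if for every $F\in\mathcal{F}$, $\sigma(t(F))$ is the $k$-th smallest element of the set $\sigma(F)=\{\sigma(i): i\in F\}$, where $k=f(t(F))$. $\mathcal{F}$ (with $|\mathcal{F}|=m'$) is shellable if there is an ordering $F_1,\dots,F_{m'}$ of its members such that $\left|\bigcup_{i=1}^k F_i\right| = k$ for every $k\in[m']$. -}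

module Defs where

open import Data.Nat as ℕ using (ℕ; suc; _≤_; _∸_; _+_; _⊓_)
open import Data.Fin as Fin using (Fin; toℕ)
open import Data.Fin.Properties using (any?; _≟_)
open import Data.Fin.Subset using (Subset; _∈_; ∣_∣; _∩_)
open import Data.Fin.Subset.Properties using (_∈?_)
open import Data.Fin.Permutation using (Permutation′; _⟨$⟩ʳ_)
open import Data.Vec using (tabulate)
open import Data.Product using (Σ; ∃; _×_)
open import Relation.Nullary.Decidable using (⌊_⌋; _×-dec_)
open import Relation.Binary.PropositionalEquality using (_≡_)
open import Function.Definitions using (Injective; Surjective)

-- A family of n subsets of [n] (a multiset indexed by Fin n); [n] is Fin n.
Family : ℕ → Set
Family n = Fin n → Subset n

unionOver : ∀ {n} → Family n → Subset n → Subset n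
unionOver F I = tabulate (λ x → ⌊ any? (λ i → (i ∈? I) ×-dec (x ∈? F i)) ⌋)

MarriageCondition : ∀ {n} → Family n → Set
MarriageCondition {n} F = (I : Subset n) → ∣ I ∣ ≤ ∣ unionOver F I ∣

IsTransversal : ∀ {n} → Family n → (Fin n → Fin n) → Set
IsTransversal F t = Injective _≡_ _≡_ t × (∀ i → t i ∈ F i)

IsConfiguration : ∀ {n} → Family n → (Fin n → Fin n) → (Fin n → ℕ) → Set
IsConfiguration F t f = (∀ x → 1 ≤ f x) × (∀ i → f (t i) ≤ ∣ F i ∣)

image : ∀ {n m} → (Fin n → Fin m) → Subset n → Subset m
image σ A = tabulate (λ j → ⌊ any? (λ x → (x ∈? A) ×-dec (σ x ≟ j)) ⌋)

below : ∀ {m} → Fin m → Subset m → Subset m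
below y A = A ∩ tabulate (λ j → ⌊ j Fin.<? y ⌋)

IsKthSmallest : ∀ {m} → ℕ → Fin m → Subset m → Set
IsKthSmallest k y A = y ∈ A × suc ∣ below y A ∣ ≡ k

Satisfies : ∀ {n m} → Family n → (Fin n → Fin n) → (Fin n → ℕ) → (Fin n → Fin m) → Set
Satisfies F t f σ = ∀ i → IsKthSmallest (f (t i)) (σ (t i)) (image σ (F i))

firstK : ∀ {n} → Family n → Permutation′ n → ℕ → Subset n
firstK F π k = tabulate (λ x → ⌊ any? (λ i → (toℕ i ℕ.<? k) ×-dec (x ∈? F (π ⟨$⟩ʳ i))) ⌋)

Shellable : ∀ {n} → Family n → Set
Shellable {n} F = Σ (Permutation′ n) λ π → ∀ k → 1 ≤ k → k ≤ n → ∣ firstK F π k ∣ ≡ k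

multiplicity : ∀ {n} → Family n → Fin n → ℕ
multiplicity F x = ∣ tabulate (λ i → ⌊ x ∈? F i ⌋) ∣

uniqueElems : ∀ {n} → Family n → Subset n
uniqueElems F = tabulate (λ x → ⌊ multiplicity F x ℕ.≟ 1 ⌋)

-- A transversal t of n members of [n] is a bijection, so F is shellable exactly when its members can be
-- ordered so that every element of a member other than its transversal element is the transversal
-- element of an earlier member, i.e. when some weight makes each t(F) the strict maximum of F.
--
-- If σ satisfies the configuration f(t(F)) = |F|, then σ(t(F)) is the largest of |F| distinct values
-- σ(F), so σ ∘ t is such a weight and sorting the members by it gives a shelling. Conversely, walking
-- along a shelling we insert each t(F) into a linear order of the elements seen so far, at the place
-- that puts exactly f(t(F)) - 1 of the other elements of F below it; the result is a bijection
-- σ : [n] → [n] satisfying f. A non-transversal element of F also lies in the member it is the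
-- transversal element of, so it is not in S; composing σ with a monotone surjection [n] → [m] that is
-- strictly increasing after the σ-value of every element outside S therefore keeps all the counts,
-- and such a surjection exists as soon as min(n, n - |S| + 1) ≤ m ≤ n.
module Submission where

open import Level using (Level)
open import Data.Bool using (true)
open import Data.Nat as ℕ using (ℕ; zero; suc; _≤_; _<_; z≤n; s≤s; _<?_; _∸_; _+_; _⊔_; _⊓_)
open import Data.Nat.Properties as ℕ using (≤-refl; ≤-trans)
open import Data.Fin as Fin using (Fin; toℕ; zero; suc; fromℕ<; punchOut)
open import Data.Fin.Properties as Fin
  using (0≢1+n; suc-injective; any?; _≟_; toℕ-injective; toℕ<n; toℕ-fromℕ<; punchOut-injective; injective⇒≤)
open import Data.Fin.Subset
open import Data.Fin.Subset.Properties
open import Data.Fin.Permutation using (Permutation′; permutation; flip; _⟨$⟩ʳ_; _⟨$⟩ˡ_; inverseˡ; inverseʳ)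
open import Data.Vec using (tabulate; _∷_; [])
open import Data.Vec.Base using (_[_]=_)
open import Data.Vec.Properties using (lookup∘tabulate; []=⇒lookup; lookup⇒[]=; tabulate-cong)
open import Data.Product using (Σ; ∃; _×_; _,_; proj₁; proj₂)
open import Data.Product.Relation.Binary.Lex.Strict using (×-strictTotalOrder)
open import Data.Sum using (inj₁)
open import Function using (_∘_)
open import Function.Bundles using (_⇔_; mk⇔)
open import Function.Definitions using (Injective; Surjective)
import Function.Construct.Composition as Compose
open import Relation.Binary.Bundles using (StrictTotalOrder)
open import Relation.Binary.Definitions using (tri<; tri≈; tri>)
open import Relation.Binary.PropositionalEquality
open import Relation.Nullary using (Dec; yes; no; ¬_; contradiction)
open import Relation.Nullary.Decidable using (⌊_⌋; _×-dec_)
open import Relation.Unary using (Pred; Decidable)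
open import Defs

open _[_]=_

private variable
  ℓ : Level
  n m m′ : ℕ

-- Counting elements of subsets

module _ {P : Pred (Fin n) ℓ} (P? : Decidable P) where

  ∈-tabulate⁺ : ∀ {x} → P x → x ∈ tabulate (⌊_⌋ ∘ P?)
  ∈-tabulate⁺ {x} px = lookup⇒[]= x _ (trans (lookup∘tabulate (⌊_⌋ ∘ P?) x) (isTrue (P? x)))
    where
    isTrue : (d : Dec (P x)) → ⌊ d ⌋ ≡ true
    isTrue (yes _)   = refl
    isTrue (no  ¬px) = contradiction px ¬px

  ∈-tabulate⁻ : ∀ {x} → x ∈ tabulate (⌊_⌋ ∘ P?) → P x
  ∈-tabulate⁻ {x} x∈ with P? x | trans (sym (lookup∘tabulate (⌊_⌋ ∘ P?) x)) ([]=⇒lookup x∈)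
  ... | yes px | _  = px
  ... | no  _  | ()

x∈p-y⇒x∈p : ∀ {p : Subset n} {x y} → x ∈ p - y → x ∈ p
x∈p-y⇒x∈p {p = p} {y = y} = p─q⊆p p ⁅ y ⁆

y∉p-y : ∀ (p : Subset n) y → y ∉ p - y
y∉p-y (_ ∷ p) (suc y) (there y∈) = y∉p-y p y y∈

x∈p-y⇒x≢y : ∀ {p : Subset n} {x y} → x ∈ p - y → x ≢ y
x∈p-y⇒x≢y {p = p} x∈ refl = y∉p-y p _ x∈

∣p∣≡1+∣p-x∣ : ∀ {p : Subset n} {x} → x ∈ p → ∣ p ∣ ≡ suc ∣ p - x ∣
∣p∣≡1+∣p-x∣ {p = inside  ∷ p} {zero}  here       = cong (suc ∘ ∣_∣) (sym (p─⊥≡p p))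
∣p∣≡1+∣p-x∣ {p = inside  ∷ p} {suc x} (there x∈) = cong suc (∣p∣≡1+∣p-x∣ x∈)
∣p∣≡1+∣p-x∣ {p = outside ∷ p} {suc x} (there x∈) = ∣p∣≡1+∣p-x∣ x∈

∣p∣≤1+∣p-x∣ : ∀ (p : Subset n) x → ∣ p ∣ ≤ suc ∣ p - x ∣
∣p∣≤1+∣p-x∣ p x with x ∈? p
... | yes x∈p = ℕ.≤-reflexive (∣p∣≡1+∣p-x∣ x∈p)
... | no  x∉p = ℕ.m≤n⇒m≤1+n (p⊆q⇒∣p∣≤∣q∣ {p = p} {q = p - x}
                  λ y∈p → x∈p∧x≢y⇒x∈p-y y∈p λ { refl → x∉p y∈p })

⊆∧∣≥∣⇒⊇ : ∀ {p q : Subset n} → p ⊆ q → ∣ q ∣ ≤ ∣ p ∣ → q ⊆ p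
⊆∧∣≥∣⇒⊇ {p = p} p⊆q ∣q∣≤∣p∣ {x} x∈q with x ∈? p
... | yes x∈p = x∈p
... | no  x∉p = contradiction ∣q∣≤∣p∣ (ℕ.<⇒≱ (p⊂q⇒∣p∣<∣q∣ (p⊆q , x , x∈q , x∉p)))

injection⇒∣p∣≤∣q∣ : ∀ {p : Subset n} {q : Subset m} (h : Fin n → Fin m) →
                    (∀ {x} → x ∈ p → h x ∈ q) →
                    (∀ {x y} → x ∈ p → y ∈ p → h x ≡ h y → x ≡ y) →
                    ∣ p ∣ ≤ ∣ q ∣
injection⇒∣p∣≤∣q∣ {p = []} h into inj = z≤n
injection⇒∣p∣≤∣q∣ {p = outside ∷ p} h into inj =
  injection⇒∣p∣≤∣q∣ (h ∘ suc) (into ∘ there) λ x∈ y∈ → suc-injective ∘ inj (there x∈) (there y∈)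
injection⇒∣p∣≤∣q∣ {p = inside ∷ p} {q} h into inj = begin
  suc ∣ p ∣          ≤⟨ s≤s (injection⇒∣p∣≤∣q∣ (h ∘ suc) into-rest λ x∈ y∈ →
                           suc-injective ∘ inj (there x∈) (there y∈)) ⟩
  suc ∣ q - h zero ∣ ≡⟨ ∣p∣≡1+∣p-x∣ (into here) ⟨
  ∣ q ∣              ∎
  where
  open ℕ.≤-Reasoning
  into-rest : ∀ {x} → x ∈ p → h (suc x) ∈ q - h zero
  into-rest x∈ = x∈p∧x≢y⇒x∈p-y (into (there x∈)) (0≢1+n ∘ sym ∘ inj (there x∈) here)

surjection⇒∣q∣≤∣p∣ : ∀ {p : Subset n} {q : Subset m} (h : Fin n → Fin m) →
                     (∀ {y} → y ∈ q → ∃ λ x → x ∈ p × h x ≡ y) →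
                     ∣ q ∣ ≤ ∣ p ∣
surjection⇒∣q∣≤∣p∣ {m = m} {p = []} {q} h onto =
  ℕ.≤-reflexive (trans (cong ∣_∣ (Empty-unique λ { (_ , y∈) → no-preimage (onto y∈) })) (∣⊥∣≡0 m))
  where
  no-preimage : ∀ {y} → ¬ ∃ (λ (x : Fin 0) → x ∈ [] × h x ≡ y)
  no-preimage (() , _)
surjection⇒∣q∣≤∣p∣ {p = outside ∷ p} h onto = surjection⇒∣q∣≤∣p∣ (h ∘ suc) (preimage-in-tail ∘ onto)
  where
  preimage-in-tail : ∀ {y} → ∃ (λ x → x ∈ outside ∷ p × h x ≡ y) → ∃ λ x → x ∈ p × h (suc x) ≡ y
  preimage-in-tail (suc x , there x∈ , eq) = x , x∈ , eq
surjection⇒∣q∣≤∣p∣ {p = inside ∷ p} {q} h onto = ≤-trans (∣p∣≤1+∣p-x∣ q (h zero))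
  (s≤s (surjection⇒∣q∣≤∣p∣ (h ∘ suc) λ y∈ →
    preimage-in-tail (x∈p-y⇒x≢y {p = q} y∈) (onto (x∈p-y⇒x∈p {p = q} y∈))))
  where
  preimage-in-tail : ∀ {y} → y ≢ h zero → ∃ (λ x → x ∈ inside ∷ p × h x ≡ y) →
                     ∃ λ x → x ∈ p × h (suc x) ≡ y
  preimage-in-tail y≢h0 (zero  , _        , eq) = contradiction (sym eq) y≢h0
  preimage-in-tail y≢h0 (suc x , there x∈ , eq) = x , x∈ , eq

bijection⇒∣p∣≡∣q∣ : ∀ {p : Subset n} {q : Subset m} (h : Fin n → Fin m) →
                    (∀ {x} → x ∈ p → h x ∈ q) →
                    (∀ {x y} → x ∈ p → y ∈ p → h x ≡ h y → x ≡ y) →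
                    (∀ {y} → y ∈ q → ∃ λ x → x ∈ p × h x ≡ y) →
                    ∣ p ∣ ≡ ∣ q ∣
bijection⇒∣p∣≡∣q∣ h into inj onto =
  ℕ.≤-antisym (injection⇒∣p∣≤∣q∣ h into inj) (surjection⇒∣q∣≤∣p∣ h onto)

segment : ∀ n → ℕ → Subset n
segment n k = tabulate λ (i : Fin n) → ⌊ toℕ i <? k ⌋

segment-suc : ∀ n k → segment (suc n) (suc k) ≡ inside ∷ segment n k
segment-suc n k = cong (inside ∷_) (tabulate-cong λ i → suc<?suc (toℕ i))
  where
  suc<?suc : ∀ a → ⌊ suc a <? suc k ⌋ ≡ ⌊ a <? k ⌋
  suc<?suc a with a <? k | suc a <? suc k
  ... | yes _   | yes _   = refl
  ... | no  _   | no  _   = refl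
  ... | yes a<k | no  a≮k = contradiction (s≤s a<k) a≮k
  ... | no  a≮k | yes a<k = contradiction (ℕ.s<s⁻¹ a<k) a≮k

∣segment∣≡k : ∀ {n k} → k ≤ n → ∣ segment n k ∣ ≡ k
∣segment∣≡k {n} {zero} _ = trans (cong ∣_∣ (Empty-unique {p = segment n 0}
  λ { (_ , i∈) → ℕ.n≮0 (∈-tabulate⁻ (λ i → toℕ i <? 0) i∈) })) (∣⊥∣≡0 n)
∣segment∣≡k {suc n} {suc k} (s≤s k≤n) = trans (cong ∣_∣ (segment-suc n k)) (cong suc (∣segment∣≡k k≤n))

lowerSet : (Fin n → ℕ) → ℕ → Subset n → Subset n
lowerSet v c D = tabulate λ d → ⌊ (d ∈? D) ×-dec (v d <? c) ⌋

module _ {v : Fin n → ℕ} {c : ℕ} {D : Subset n} where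

  ∈-lowerSet⁺ : ∀ {d} → d ∈ D → v d < c → d ∈ lowerSet v c D
  ∈-lowerSet⁺ d∈D vd<c = ∈-tabulate⁺ (λ d → (d ∈? D) ×-dec (v d <? c)) (d∈D , vd<c)

  ∈-lowerSet⁻ : ∀ {d} → d ∈ lowerSet v c D → d ∈ D × v d < c
  ∈-lowerSet⁻ = ∈-tabulate⁻ (λ d → (d ∈? D) ×-dec (v d <? c))

∣lowerSet∣-cong : ∀ {v v′ : Fin n → ℕ} {c c′ D} →
                  (∀ {d} → d ∈ D → v d < c → v′ d < c′) → (∀ {d} → d ∈ D → v′ d < c′ → v d < c) →
                  ∣ lowerSet v c D ∣ ≡ ∣ lowerSet v′ c′ D ∣
∣lowerSet∣-cong {v = v} {v′} {c} {c′} {D} to from =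
  bijection⇒∣p∣≡∣q∣ {p = lowerSet v c D} {q = lowerSet v′ c′ D} (λ d → d)
    (λ d∈ → let d∈D , lt = ∈-lowerSet⁻ d∈ in ∈-lowerSet⁺ d∈D (to d∈D lt))
    (λ _ _ eq → eq)
    (λ d∈ → let d∈D , lt = ∈-lowerSet⁻ d∈ in _ , ∈-lowerSet⁺ d∈D (from d∈D lt) , refl)

∣lowerSet∣≤∣D∣ : ∀ (v : Fin n → ℕ) c D → ∣ lowerSet v c D ∣ ≤ ∣ D ∣
∣lowerSet∣≤∣D∣ v c D = p⊆q⇒∣p∣≤∣q∣ {p = lowerSet v c D} (proj₁ ∘ ∈-lowerSet⁻)

∣lowerSet∣-mono : ∀ (v : Fin n → ℕ) {c c′} D → c ≤ c′ → ∣ lowerSet v c D ∣ ≤ ∣ lowerSet v c′ D ∣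
∣lowerSet∣-mono v {c} D c≤c′ = p⊆q⇒∣p∣≤∣q∣ {p = lowerSet v c D} λ d∈ →
  let d∈D , lt = ∈-lowerSet⁻ d∈ in ∈-lowerSet⁺ d∈D (ℕ.<-≤-trans lt c≤c′)

∣lowerSet∣-zero : ∀ (v : Fin n → ℕ) D → ∣ lowerSet v 0 D ∣ ≡ 0
∣lowerSet∣-zero {n} v D = trans (cong ∣_∣ (Empty-unique {p = lowerSet v 0 D}
  λ (_ , d∈) → ℕ.n≮0 (proj₂ (∈-lowerSet⁻ d∈)))) (∣⊥∣≡0 n)

∣lowerSet∣-all : ∀ {v : Fin n → ℕ} {c D} → (∀ {d} → d ∈ D → v d < c) → ∣ lowerSet v c D ∣ ≡ ∣ D ∣
∣lowerSet∣-all {v = v} {c} {D} all-below = ℕ.≤-antisym (∣lowerSet∣≤∣D∣ v c D)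
  (p⊆q⇒∣p∣≤∣q∣ {p = D} λ d∈D → ∈-lowerSet⁺ d∈D (all-below d∈D))

∣lowerSet∣-suc≤ : ∀ {v : Fin n → ℕ} {D} → (∀ {x y} → x ∈ D → y ∈ D → v x ≡ v y → x ≡ y) →
                  ∀ c → ∣ lowerSet v (suc c) D ∣ ≤ suc ∣ lowerSet v c D ∣
∣lowerSet∣-suc≤ {n} {v} {D} v-injective c with any? (λ d → (d ∈? D) ×-dec (v d ℕ.≟ c))
... | yes (d , d∈D , vd≡c) = ≤-trans (∣p∣≤1+∣p-x∣ L d) (s≤s (p⊆q⇒∣p∣≤∣q∣ {p = L - d} λ x∈ →
        let x∈D , vx<1+c = ∈-lowerSet⁻ (x∈p-y⇒x∈p {p = L} x∈) in
        ∈-lowerSet⁺ x∈D (ℕ.≤∧≢⇒< (ℕ.s≤s⁻¹ vx<1+c) λ vx≡c →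
          x∈p-y⇒x≢y {p = L} x∈ (v-injective x∈D d∈D (trans vx≡c (sym vd≡c))))))
  where
  L : Subset n
  L = lowerSet v (suc c) D
... | no  none = ℕ.m≤n⇒m≤1+n (p⊆q⇒∣p∣≤∣q∣ {p = lowerSet v (suc c) D} λ x∈ →
        let x∈D , vx<1+c = ∈-lowerSet⁻ x∈ in
        ∈-lowerSet⁺ x∈D (ℕ.≤∧≢⇒< (ℕ.s≤s⁻¹ vx<1+c) λ vx≡c → none (_ , x∈D , vx≡c)))

1+∣lowerSet∣≤∣lowerSet-suc∣ : ∀ {v : Fin n → ℕ} {D d} → d ∈ D →
                             suc ∣ lowerSet v (v d) D ∣ ≤ ∣ lowerSet v (suc (v d)) D ∣
1+∣lowerSet∣≤∣lowerSet-suc∣ {v = v} {D} {d} d∈D = p⊂q⇒∣p∣<∣q∣ {p = lowerSet v (v d) D}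
  ( (λ x∈ → let x∈D , lt = ∈-lowerSet⁻ x∈ in ∈-lowerSet⁺ x∈D (ℕ.m≤n⇒m≤1+n lt))
  , _ , ∈-lowerSet⁺ d∈D ≤-refl , ℕ.<-irrefl refl ∘ proj₂ ∘ ∈-lowerSet⁻)

discrete-ivt : (g : ℕ → ℕ) → (∀ s → g (suc s) ≤ suc (g s)) →
               ∀ N {τ} → g 0 ≤ τ → τ ≤ g N → ∃ λ s → s ≤ N × g s ≡ τ
discrete-ivt g step zero    g0≤τ τ≤g0 = 0 , z≤n , ℕ.≤-antisym g0≤τ τ≤g0
discrete-ivt g step (suc N) {τ} g0≤τ τ≤g[1+N] with τ ℕ.≤? g N
... | yes τ≤gN = let s , s≤N , gs≡τ = discrete-ivt g step N g0≤τ τ≤gN in s , ℕ.m≤n⇒m≤1+n s≤N , gs≡τ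
... | no  τ≰gN = suc N , ≤-refl , ℕ.≤-antisym (≤-trans (step N) (ℕ.≰⇒> τ≰gN)) τ≤g[1+N]

-- Images and k-th smallest elements

module _ (σ : Fin n → Fin m) (p : Subset n) where

  ∈-image⁺ : ∀ {x} → x ∈ p → σ x ∈ image σ p
  ∈-image⁺ {x} x∈p = ∈-tabulate⁺ (λ j → any? λ x → (x ∈? p) ×-dec (σ x ≟ j)) (x , x∈p , refl)

  ∈-image⁻ : ∀ {j} → j ∈ image σ p → ∃ λ x → x ∈ p × σ x ≡ j
  ∈-image⁻ = ∈-tabulate⁻ (λ j → any? λ x → (x ∈? p) ×-dec (σ x ≟ j))

  ∣image∣≤∣p∣ : ∣ image σ p ∣ ≤ ∣ p ∣
  ∣image∣≤∣p∣ = surjection⇒∣q∣≤∣p∣ σ ∈-image⁻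

module _ {A : Subset m} {y : Fin m} where

  ∈-below⁺ : ∀ {j} → j ∈ A → j Fin.< y → j ∈ below y A
  ∈-below⁺ j∈A j<y = x∈p∩q⁺ (j∈A , ∈-tabulate⁺ (Fin._<? y) j<y)

  ∈-below⁻ : ∀ {j} → j ∈ below y A → j ∈ A × j Fin.< y
  ∈-below⁻ j∈ = let j∈A , j∈< = x∈p∩q⁻ A _ j∈ in j∈A , ∈-tabulate⁻ (Fin._<? y) j∈<

module _ (σ : Fin n → Fin m) {A : Subset n} {z : Fin n} (z∈A : z ∈ A) where

  ∈-below-image⁻ : ∀ {j} → j ∈ below (σ z) (image σ A) → ∃ λ x → x ∈ A × x ≢ z × σ x ≡ j
  ∈-below-image⁻ j∈ with ∈-below⁻ j∈
  ... | j∈I , j<σz with ∈-image⁻ σ A j∈I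
  ...   | x , x∈A , refl = x , x∈A , (λ { refl → ℕ.<-irrefl refl j<σz }) , refl

  ∣below∣≡∣lowerSet∣ : (∀ {x y} → x ∈ A → y ∈ A → σ x ≡ σ y → x ≡ y) →
                       ∣ below (σ z) (image σ A) ∣ ≡ ∣ lowerSet (toℕ ∘ σ) (toℕ (σ z)) (A - z) ∣
  ∣below∣≡∣lowerSet∣ σ-injective = sym (bijection⇒∣p∣≡∣q∣ {p = lowerSet (toℕ ∘ σ) (toℕ (σ z)) (A - z)} σ
    (λ d∈ → let d∈A-z , σd<σz = ∈-lowerSet⁻ d∈ in ∈-below⁺ (∈-image⁺ σ A (x∈p-y⇒x∈p d∈A-z)) σd<σz)
    (λ d∈ d′∈ → σ-injective (x∈p-y⇒x∈p (proj₁ (∈-lowerSet⁻ d∈)))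
                            (x∈p-y⇒x∈p (proj₁ (∈-lowerSet⁻ d′∈))))
    λ j∈ → let x , x∈A , x≢z , σx≡j = ∈-below-image⁻ j∈ in
      x , ∈-lowerSet⁺ (x∈p∧x≢y⇒x∈p-y x∈A x≢z) (subst (Fin._< σ z) (sym σx≡j) (proj₂ (∈-below⁻ j∈)))
        , σx≡j)

  ∣A∣thSmallest⇒maximum : IsKthSmallest ∣ A ∣ (σ z) (image σ A) → ∀ {y} → y ∈ A → y ≢ z → σ y Fin.< σ z
  ∣A∣thSmallest⇒maximum (σz∈I , 1+∣B∣≡∣A∣) {y} y∈A y≢z =
    proj₂ (∈-below⁻ (I-σz⊆B (x∈p∧x≢y⇒x∈p-y (∈-image⁺ σ A y∈A) σy≢σz)))
    where
    open ℕ.≤-Reasoning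

    I B : Subset m
    I = image σ A
    B = below (σ z) I

    B⊆I-σz : B ⊆ I - σ z
    B⊆I-σz j∈ = let j∈I , j<σz = ∈-below⁻ j∈ in x∈p∧x≢y⇒x∈p-y j∈I λ { refl → ℕ.<-irrefl refl j<σz }

    ∣I∣≡1+∣I-σz∣ : ∣ I ∣ ≡ suc ∣ I - σ z ∣
    ∣I∣≡1+∣I-σz∣ = ∣p∣≡1+∣p-x∣ σz∈I

    I-σz⊆B : I - σ z ⊆ B
    I-σz⊆B = ⊆∧∣≥∣⇒⊇ B⊆I-σz (ℕ.s≤s⁻¹ (begin
      suc ∣ I - σ z ∣ ≡⟨ ∣I∣≡1+∣I-σz∣ ⟨
      ∣ I ∣           ≤⟨ ∣image∣≤∣p∣ σ A ⟩
      ∣ A ∣           ≡⟨ 1+∣B∣≡∣A∣ ⟨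
      suc ∣ B ∣       ∎))

    σy≢σz : σ y ≢ σ z
    σy≢σz σy≡σz = ℕ.<-irrefl refl (begin-strict
      ∣ A - y ∣           <⟨ ℕ.≤-reflexive (sym (∣p∣≡1+∣p-x∣ y∈A)) ⟩
      ∣ A ∣               ≡⟨ 1+∣B∣≡∣A∣ ⟨
      suc ∣ B ∣           ≤⟨ s≤s (p⊆q⇒∣p∣≤∣q∣ B⊆I-σz) ⟩
      suc ∣ I - σ z ∣     ≡⟨ ∣I∣≡1+∣I-σz∣ ⟨
      ∣ I ∣               ≤⟨ p⊆q⇒∣p∣≤∣q∣ I⊆σ[A-y] ⟩
      ∣ image σ (A - y) ∣ ≤⟨ ∣image∣≤∣p∣ σ (A - y) ⟩
      ∣ A - y ∣           ∎)
      where
      I⊆σ[A-y] : I ⊆ image σ (A - y)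
      I⊆σ[A-y] j∈ with ∈-image⁻ σ A j∈
      ... | x , x∈A , refl with x Fin.≟ y
      ...   | yes refl = subst (_∈ image σ (A - y)) (sym σy≡σz)
                           (∈-image⁺ σ (A - y) (x∈p∧x≢y⇒x∈p-y z∈A (y≢z ∘ sym)))
      ...   | no  x≢y  = ∈-image⁺ σ (A - y) (x∈p∧x≢y⇒x∈p-y x∈A x≢y)

  kthSmallest-∘ : ∀ {k} (g : Fin m → Fin m′) →
                  (∀ {i j} → i Fin.≤ j → g i Fin.≤ g j) →
                  (∀ {y j} → y ∈ A → y ≢ z → σ y Fin.< j → g (σ y) Fin.< g j) →
                  IsKthSmallest k (σ z) (image σ A) → IsKthSmallest k (g (σ z)) (image (g ∘ σ) A)
  kthSmallest-∘ {m′} g g-mono g-strict (_ , 1+∣B∣≡k) =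
    ∈-image⁺ (g ∘ σ) A z∈A , trans (cong suc (sym ∣B∣≡∣B′∣)) 1+∣B∣≡k
    where
    B : Subset m
    B = below (σ z) (image σ A)

    B′ : Subset m′
    B′ = below (g (σ z)) (image (g ∘ σ) A)

    ∣B∣≡∣B′∣ : ∣ B ∣ ≡ ∣ B′ ∣
    ∣B∣≡∣B′∣ = bijection⇒∣p∣≡∣q∣ g into injective onto
      where
      into : ∀ {j} → j ∈ B → g j ∈ B′
      into j∈ with ∈-below-image⁻ j∈
      ... | x , x∈A , x≢z , refl =
        ∈-below⁺ (∈-image⁺ (g ∘ σ) A x∈A) (g-strict x∈A x≢z (proj₂ (∈-below⁻ j∈)))

      injective : ∀ {i j} → i ∈ B → j ∈ B → g i ≡ g j → i ≡ j
      injective i∈ j∈ gi≡gj with ∈-below-image⁻ i∈ | ∈-below-image⁻ j∈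
      ... | x , x∈A , x≢z , refl | y , y∈A , y≢z , refl with Fin.<-cmp (σ x) (σ y)
      ...   | tri< σx<σy _ _ = contradiction (cong toℕ gi≡gj) (ℕ.<⇒≢ (g-strict x∈A x≢z σx<σy))
      ...   | tri≈ _ σx≡σy _ = σx≡σy
      ...   | tri> _ _ σx>σy = contradiction (cong toℕ (sym gi≡gj)) (ℕ.<⇒≢ (g-strict y∈A y≢z σx>σy))

      onto : ∀ {j} → j ∈ B′ → ∃ λ i → i ∈ B × g i ≡ j
      onto j∈ with ∈-below⁻ j∈
      ... | j∈I′ , j<gσz with ∈-image⁻ (g ∘ σ) A j∈I′
      ...   | x , x∈A , refl = σ x , ∈-below⁺ (∈-image⁺ σ A x∈A) (ℕ.≰⇒> (ℕ.<⇒≱ j<gσz ∘ g-mono)) , refl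

-- Permutations of Fin n

injective⇒surjective : ∀ {f : Fin n → Fin n} → Injective _≡_ _≡_ f → ∀ y → ∃ λ x → f x ≡ y
injective⇒surjective {suc n} {f} f-injective y with any? (λ x → f x ≟ y)
... | yes found  = found
... | no  missed = contradiction (injective⇒≤ punchedOut-injective) ℕ.1+n≰n
  where
  y≢f : ∀ x → y ≢ f x
  y≢f x y≡fx = missed (x , sym y≡fx)

  punchedOut-injective : Injective _≡_ _≡_ (λ x → punchOut (y≢f x))
  punchedOut-injective = f-injective ∘ punchOut-injective (y≢f _) (y≢f _)

injective⇒permutation : (f : Fin n → Fin n) → Injective _≡_ _≡_ f → Permutation′ n
injective⇒permutation f f-injective =
  permutation f (proj₁ ∘ onto) (proj₂ ∘ onto) (λ x → f-injective (proj₂ (onto (f x))))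
  where
  onto : ∀ y → ∃ λ x → f x ≡ y
  onto = injective⇒surjective f-injective

module Ranking {a ℓ₁ ℓ₂} (S : StrictTotalOrder a ℓ₁ ℓ₂) {n : ℕ}
               (κ : Fin n → StrictTotalOrder.Carrier S)
               (κ-injective : ∀ {i j} → StrictTotalOrder._≈_ S (κ i) (κ j) → i ≡ j) where

  open StrictTotalOrder S using (compare; module Eq)
    renaming (_<_ to _≺_; _<?_ to _≺?_; trans to ≺-trans; irrefl to ≺-irrefl)

  smallerKeys : Fin n → Subset n
  smallerKeys i = tabulate λ j → ⌊ κ j ≺? κ i ⌋

  i∉smallerKeys : ∀ i → i ∉ smallerKeys i
  i∉smallerKeys i = ≺-irrefl Eq.refl ∘ ∈-tabulate⁻ (λ k → κ k ≺? κ i)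

  smallerKeys-mono : ∀ {i j} → κ i ≺ κ j → ∣ smallerKeys i ∣ ℕ.< ∣ smallerKeys j ∣
  smallerKeys-mono {i} {j} κi≺κj = p⊂q⇒∣p∣<∣q∣
    ( (λ k∈ → ∈-tabulate⁺ (λ k → κ k ≺? κ j) (≺-trans (∈-tabulate⁻ (λ k → κ k ≺? κ i) k∈) κi≺κj))
    , i , ∈-tabulate⁺ (λ k → κ k ≺? κ j) κi≺κj , i∉smallerKeys i)

  ∣smallerKeys∣<n : ∀ i → ∣ smallerKeys i ∣ ℕ.< n
  ∣smallerKeys∣<n i = subst (∣ smallerKeys i ∣ ℕ.<_) (∣⊤∣≡n n) (p⊂q⇒∣p∣<∣q∣ (⊆⊤ , i , ∈⊤ , i∉smallerKeys i))

  rank : Fin n → Fin n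
  rank i = fromℕ< (∣smallerKeys∣<n i)

  rank-mono : ∀ {i j} → κ i ≺ κ j → rank i Fin.< rank j
  rank-mono {i} {j} κi≺κj =
    subst₂ ℕ._<_ (sym (toℕ-fromℕ< (∣smallerKeys∣<n i))) (sym (toℕ-fromℕ< (∣smallerKeys∣<n j)))
      (smallerKeys-mono κi≺κj)

  rank-injective : Injective _≡_ _≡_ rank
  rank-injective {i} {j} rᵢ≡rⱼ with compare (κ i) (κ j)
  ... | tri< κi≺κj _ _ = contradiction (cong toℕ rᵢ≡rⱼ) (ℕ.<⇒≢ (rank-mono κi≺κj))
  ... | tri≈ _ κi≈κj _ = κ-injective κi≈κj
  ... | tri> _ _ κi≻κj = contradiction (cong toℕ (sym rᵢ≡rⱼ)) (ℕ.<⇒≢ (rank-mono κi≻κj))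

sortingPermutation : (w : Fin n → ℕ) →
                     Σ (Permutation′ n) λ π → ∀ {i j} → w i < w j → π ⟨$⟩ˡ i Fin.< π ⟨$⟩ˡ j
sortingPermutation {n} w = flip (injective⇒permutation rank rank-injective) , rank-mono ∘ inj₁
  where
  open Ranking (×-strictTotalOrder ℕ.<-strictTotalOrder (Fin.<-strictTotalOrder n)) (λ i → w i , i) proj₂

-- Inserting one value into a ranking

shiftFrom : ℕ → ℕ → ℕ
shiftFrom c a with a <? c
... | yes _ = a
... | no  _ = suc a

shiftFrom≤1+ : ∀ c a → shiftFrom c a ≤ suc a
shiftFrom≤1+ c a with a <? c
... | yes _ = ℕ.n≤1+n a
... | no  _ = ≤-refl

shiftFrom≢c : ∀ c a → shiftFrom c a ≢ c
shiftFrom≢c c a with a <? c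
... | yes a<c = ℕ.<⇒≢ a<c
... | no  a≮c = a≮c ∘ ℕ.≤-reflexive

shiftFrom<c⇒<c : ∀ {c a} → shiftFrom c a < c → a < c
shiftFrom<c⇒<c {c} {a} with a <? c
... | yes a<c = λ _ → a<c
... | no  _   = ℕ.<-trans (ℕ.n<1+n a)

<c⇒shiftFrom<c : ∀ {c a} → a < c → shiftFrom c a < c
<c⇒shiftFrom<c {c} {a} a<c with a <? c
... | yes _   = a<c
... | no  a≮c = contradiction a<c a≮c

shiftFrom-mono-< : ∀ c {a b} → a < b → shiftFrom c a < shiftFrom c b
shiftFrom-mono-< c {a} {b} a<b with a <? c | b <? c
... | yes _   | yes _   = a<b
... | yes _   | no  _   = ℕ.m≤n⇒m≤1+n a<b
... | no  a≮c | yes b<c = contradiction (ℕ.<-trans a<b b<c) a≮c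
... | no  _   | no  _   = s≤s a<b

shiftFrom-cancel-< : ∀ c {a b} → shiftFrom c a < shiftFrom c b → a < b
shiftFrom-cancel-< c {a} {b} lt with ℕ.<-cmp a b
... | tri< a<b _ _  = a<b
... | tri≈ _ refl _ = contradiction lt (ℕ.<-irrefl refl)
... | tri> _ _ a>b  = contradiction lt (ℕ.<-asym (shiftFrom-mono-< c a>b))

shiftFrom-injective : ∀ c {a b} → shiftFrom c a ≡ shiftFrom c b → a ≡ b
shiftFrom-injective c {a} {b} eq with ℕ.<-cmp a b
... | tri< a<b _ _ = contradiction eq (ℕ.<⇒≢ (shiftFrom-mono-< c a<b))
... | tri≈ _ a≡b _ = a≡b
... | tri> _ _ a>b = contradiction (sym eq) (ℕ.<⇒≢ (shiftFrom-mono-< c a>b))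

insertAt : Fin n → ℕ → (Fin n → ℕ) → Fin n → ℕ
insertAt e c v x with x ≟ e
... | yes _ = c
... | no  _ = shiftFrom c (v x)

module _ {e : Fin n} {c : ℕ} {v : Fin n → ℕ} where

  insertAt-≡ : insertAt e c v e ≡ c
  insertAt-≡ with e ≟ e
  ... | yes _   = refl
  ... | no  e≢e = contradiction refl e≢e

  insertAt-≢ : ∀ {x} → x ≢ e → insertAt e c v x ≡ shiftFrom c (v x)
  insertAt-≢ {x} x≢e with x ≟ e
  ... | yes x≡e = contradiction x≡e x≢e
  ... | no  _   = refl

-- Monotone surjections Fin n → Fin m

module Compression {n m} (T : Subset (suc n)) (bound : suc n ⊓ suc ∣ T ∣ ≤ suc m) (m≤n : m ≤ n) where

  d : ℕ
  d = n ∸ m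

  countBelow : ℕ → ℕ
  countBelow p = ∣ lowerSet toℕ p T ∣

  countBelow-step : ∀ p → countBelow (suc p) ≤ suc (countBelow p)
  countBelow-step = ∣lowerSet∣-suc≤ {v = toℕ} {D = T} λ _ _ → toℕ-injective

  countBelow≤ : ∀ p → countBelow p ≤ p
  countBelow≤ zero    = ℕ.≤-reflexive (∣lowerSet∣-zero toℕ T)
  countBelow≤ (suc p) = ≤-trans (countBelow-step p) (s≤s (countBelow≤ p))

  -- Counting the points of T below p makes g₀ strict after them; the lower bound p ∸ d, which grows
  -- by one per step from position d on, makes g₀ reach m at the last position n.
  g₀ : ℕ → ℕ
  g₀ p = countBelow p ⊔ (p ∸ d)

  g₀-zero : g₀ 0 ≡ 0
  g₀-zero = cong₂ _⊔_ (∣lowerSet∣-zero toℕ T) (ℕ.0∸n≡0 d)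

  g₀-step : ∀ p → g₀ (suc p) ≤ suc (g₀ p)
  g₀-step p = ℕ.⊔-mono-≤ (countBelow-step p)
    (ℕ.m≤n+o⇒m∸n≤o (suc p) d (subst (suc p ≤_) (sym (ℕ.+-suc d (p ∸ d))) (s≤s (ℕ.m≤n+m∸n p d))))

  g₀-mono : ∀ {p q} → p ≤ q → g₀ p ≤ g₀ q
  g₀-mono p≤q = ℕ.⊔-mono-≤ (∣lowerSet∣-mono toℕ T p≤q) (ℕ.∸-monoˡ-≤ d p≤q)

  g₀-strict : ∀ {x} → x ∈ T → ∀ {q} → toℕ x < q → g₀ (toℕ x) < g₀ q
  g₀-strict {x} x∈T {q} x<q = ℕ.⊔-lub count< ∸<
    where
    count< : suc (countBelow (toℕ x)) ≤ g₀ q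
    count< = ≤-trans (1+∣lowerSet∣≤∣lowerSet-suc∣ {v = toℕ} x∈T)
               (≤-trans (∣lowerSet∣-mono toℕ T x<q) (ℕ.m≤m⊔n _ _))

    ∸< : suc (toℕ x ∸ d) ≤ g₀ q
    ∸< with d ℕ.≤? toℕ x
    ... | yes d≤x = ≤-trans (ℕ.∸-monoˡ-< x<q d≤x) (ℕ.m≤n⊔m _ _)
    ... | no  d≰x = subst (λ k → suc k ≤ g₀ q) (sym (ℕ.m≤n⇒m∸n≡0 (ℕ.<⇒≤ (ℕ.≰⇒> d≰x))))
                      (≤-trans (s≤s z≤n) count<)

  g₀<1+m : ∀ {p} → p < suc n → g₀ p < suc m
  g₀<1+m {p} p<1+n = ℕ.⊔-lub
    (≤-trans (ℕ.⊓-glb (s≤s (≤-trans (countBelow≤ p) (ℕ.s≤s⁻¹ p<1+n)))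
                      (s≤s (∣lowerSet∣≤∣D∣ toℕ p T)))
             bound)
    (s≤s (≤-trans (ℕ.∸-monoˡ-≤ d (ℕ.s≤s⁻¹ p<1+n)) (ℕ.≤-reflexive (ℕ.m∸[m∸n]≡n m≤n))))

  g : Fin (suc n) → Fin (suc m)
  g x = fromℕ< (g₀<1+m (toℕ<n x))

  toℕ∘g : ∀ x → toℕ (g x) ≡ g₀ (toℕ x)
  toℕ∘g x = toℕ-fromℕ< (g₀<1+m (toℕ<n x))

  g-mono : ∀ {x y} → x Fin.≤ y → g x Fin.≤ g y
  g-mono {x} {y} x≤y = subst₂ _≤_ (sym (toℕ∘g x)) (sym (toℕ∘g y)) (g₀-mono x≤y)

  g-strict : ∀ {x y} → x ∈ T → x Fin.< y → g x Fin.< g y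
  g-strict {x} {y} x∈T x<y = subst₂ _<_ (sym (toℕ∘g x)) (sym (toℕ∘g y)) (g₀-strict x∈T x<y)

  g-surjective : Surjective _≡_ _≡_ g
  g-surjective j = x , λ { refl → toℕ-injective (trans (toℕ∘g x) (trans (cong g₀ (toℕ-fromℕ< p<1+n)) g₀p≡j)) }
    where
    m≤g₀n : m ≤ g₀ n
    m≤g₀n = ≤-trans (ℕ.≤-reflexive (sym (ℕ.m∸[m∸n]≡n m≤n))) (ℕ.m≤n⊔m _ _)

    reached : ∃ λ p → p ≤ n × g₀ p ≡ toℕ j
    reached = discrete-ivt g₀ g₀-step n (ℕ.≤-trans (ℕ.≤-reflexive g₀-zero) z≤n)
                (≤-trans (ℕ.s≤s⁻¹ (toℕ<n j)) m≤g₀n)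

    p<1+n : proj₁ reached < suc n
    p<1+n = s≤s (proj₁ (proj₂ reached))

    g₀p≡j : g₀ (proj₁ reached) ≡ toℕ j
    g₀p≡j = proj₂ (proj₂ reached)

    x : Fin (suc n)
    x = fromℕ< p<1+n

compression : (T : Subset n) → n ⊓ suc ∣ T ∣ ≤ m → m ≤ n →
              Σ (Fin n → Fin m) λ g → Surjective _≡_ _≡_ g ×
                                      (∀ {x y} → x Fin.≤ y → g x Fin.≤ g y) ×
                                      (∀ {x y} → x ∈ T → x Fin.< y → g x Fin.< g y)
compression {zero}  {zero}  T _     _         = (λ ()) , (λ ()) , (λ { {()} }) , λ { {()} }
compression {suc n} {suc m} T bound (s≤s m≤n) = g , g-surjective , g-mono , g-strict
  where open Compression T bound m≤n

-- Transversals, shellings and configurations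

module Transversal (F : Family n) (t : Fin n → Fin n) (t-transversal : IsTransversal F t) where

  t-permutation : Permutation′ n
  t-permutation = injective⇒permutation t (proj₁ t-transversal)

  t⁻¹ : Fin n → Fin n
  t⁻¹ y = t-permutation ⟨$⟩ˡ y

  t∘t⁻¹ : ∀ y → t (t⁻¹ y) ≡ y
  t∘t⁻¹ y = inverseʳ t-permutation

  t⁻¹∘t : ∀ i → t⁻¹ (t i) ≡ i
  t⁻¹∘t i = inverseˡ t-permutation

  ∈-F∘t⁻¹ : ∀ y → y ∈ F (t⁻¹ y)
  ∈-F∘t⁻¹ y = subst (_∈ F (t⁻¹ y)) (t∘t⁻¹ y) (proj₂ t-transversal (t⁻¹ y))

  TransversalMaximal : (Fin n → ℕ) → Set
  TransversalMaximal w = ∀ i {y} → y ∈ F i → y ≢ t i → w y < w (t i)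

  non-transversal⇒∉uniqueElems : ∀ {i y} → y ∈ F i → y ≢ t i → y ∉ uniqueElems F
  non-transversal⇒∉uniqueElems {i} {y} y∈Fi y≢ti y∈S = ℕ.<-irrefl (sym multiplicity≡1) (begin-strict
    1                 <⟨ s≤s (≤-trans (s≤s z≤n) (ℕ.≤-reflexive (sym (∣p∣≡1+∣p-x∣ {p = M - i} t⁻¹y∈M-i)))) ⟩
    suc ∣ M - i ∣     ≡⟨ ∣p∣≡1+∣p-x∣ i∈M ⟨
    multiplicity F y  ∎)
    where
    open ℕ.≤-Reasoning

    M : Subset n
    M = tabulate λ j → ⌊ y ∈? F j ⌋

    multiplicity≡1 : multiplicity F y ≡ 1
    multiplicity≡1 = ∈-tabulate⁻ (λ x → multiplicity F x ℕ.≟ 1) y∈S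

    i∈M : i ∈ M
    i∈M = ∈-tabulate⁺ (λ j → y ∈? F j) y∈Fi

    t⁻¹y∈M-i : t⁻¹ y ∈ M - i
    t⁻¹y∈M-i = x∈p∧x≢y⇒x∈p-y (∈-tabulate⁺ (λ j → y ∈? F j) (∈-F∘t⁻¹ y))
      λ t⁻¹y≡i → y≢ti (trans (sym (t∘t⁻¹ y)) (cong t t⁻¹y≡i))

  module Shelling (π : Permutation′ n) where

    level : Fin n → Fin n
    level y = π ⟨$⟩ˡ t⁻¹ y

    introducedAt : Fin n → Fin n
    introducedAt j = t (π ⟨$⟩ʳ j)

    level∘introducedAt : ∀ j → level (introducedAt j) ≡ j
    level∘introducedAt j = trans (cong (π ⟨$⟩ˡ_) (t⁻¹∘t _)) (inverseˡ π)

    introducedAt∘level : ∀ y → introducedAt (level y) ≡ y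
    introducedAt∘level y = trans (cong t (inverseʳ π)) (t∘t⁻¹ y)

    level-injective : ∀ {x y} → level x ≡ level y → x ≡ y
    level-injective {x} {y} eq =
      trans (sym (introducedAt∘level x)) (trans (cong introducedAt eq) (introducedAt∘level y))

    ∈-F-at-level : ∀ y → y ∈ F (π ⟨$⟩ʳ level y)
    ∈-F-at-level y = subst (λ i → y ∈ F i) (sym (inverseʳ π)) (∈-F∘t⁻¹ y)

    ∈-firstK⁺ : ∀ {k j y} → toℕ j < k → y ∈ F (π ⟨$⟩ʳ j) → y ∈ firstK F π k
    ∈-firstK⁺ {k} {j} j<k y∈ =
      ∈-tabulate⁺ (λ x → any? λ i → (toℕ i <? k) ×-dec (x ∈? F (π ⟨$⟩ʳ i))) (j , j<k , y∈)

    ∈-firstK⁻ : ∀ {k y} → y ∈ firstK F π k → ∃ λ j → toℕ j < k × y ∈ F (π ⟨$⟩ʳ j)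
    ∈-firstK⁻ {k} = ∈-tabulate⁻ (λ x → any? λ i → (toℕ i <? k) ×-dec (x ∈? F (π ⟨$⟩ʳ i)))

    levelsBelow : ℕ → Subset n
    levelsBelow k = tabulate λ y → ⌊ toℕ (level y) <? k ⌋

    ∣levelsBelow∣≡k : ∀ {k} → k ≤ n → ∣ levelsBelow k ∣ ≡ k
    ∣levelsBelow∣≡k {k} k≤n = trans (bijection⇒∣p∣≡∣q∣ level
      (∈-tabulate⁺ (λ j → toℕ j <? k) ∘ ∈-tabulate⁻ (λ y → toℕ (level y) <? k))
      (λ _ _ → level-injective)
      (λ {j} j∈ → introducedAt j
                , ∈-tabulate⁺ (λ y → toℕ (level y) <? k)
                    (subst (λ j → toℕ j < k) (sym (level∘introducedAt j)) (∈-tabulate⁻ (λ j → toℕ j <? k) j∈))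
                , level∘introducedAt j))
      (∣segment∣≡k k≤n)

    levelsBelow⊆firstK : ∀ {k} → levelsBelow k ⊆ firstK F π k
    levelsBelow⊆firstK {k} {y} y∈ = ∈-firstK⁺ (∈-tabulate⁻ (λ y → toℕ (level y) <? k) y∈) (∈-F-at-level y)

    IsShelling : Set
    IsShelling = ∀ k → 1 ≤ k → k ≤ n → ∣ firstK F π k ∣ ≡ k

    levelsBounded⇒shelling : (∀ j {y} → y ∈ F (π ⟨$⟩ʳ j) → level y Fin.≤ j) → IsShelling
    levelsBounded⇒shelling bounded k _ k≤n = trans (cong ∣_∣ firstK≡levelsBelow) (∣levelsBelow∣≡k k≤n)
      where
      firstK≡levelsBelow : firstK F π k ≡ levelsBelow k
      firstK≡levelsBelow = ⊆-antisym
        (λ y∈ → let j , j<k , y∈F = ∈-firstK⁻ y∈ in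
          ∈-tabulate⁺ (λ y → toℕ (level y) <? k) (ℕ.≤-<-trans (bounded j y∈F) j<k))
        levelsBelow⊆firstK

    shelling⇒transversalMaximal : IsShelling → TransversalMaximal (toℕ ∘ level)
    shelling⇒transversalMaximal shelling i {y} y∈Fi y≢ti =
      ℕ.≤∧≢⇒< (ℕ.s≤s⁻¹ level-y<K) (y≢ti ∘ level-injective ∘ toℕ-injective)
      where
      K : ℕ
      K = suc (toℕ (level (t i)))

      K≤n : K ≤ n
      K≤n = toℕ<n (level (t i))

      π[level-ti]≡i : π ⟨$⟩ʳ level (t i) ≡ i
      π[level-ti]≡i = trans (inverseʳ π) (t⁻¹∘t i)

      firstK⊆levelsBelow : firstK F π K ⊆ levelsBelow K
      firstK⊆levelsBelow = ⊆∧∣≥∣⇒⊇ levelsBelow⊆firstK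
        (ℕ.≤-reflexive (trans (shelling K (s≤s z≤n) K≤n) (sym (∣levelsBelow∣≡k K≤n))))

      level-y<K : toℕ (level y) < K
      level-y<K = ∈-tabulate⁻ (λ y → toℕ (level y) <? K)
        (firstK⊆levelsBelow (∈-firstK⁺ ≤-refl (subst (λ i → y ∈ F i) (sym π[level-ti]≡i) y∈Fi)))

  transversalMaximal⇒shellable : ∀ {w} → TransversalMaximal w → Shellable F
  transversalMaximal⇒shellable {w} maximal = sortedShelling (sortingPermutation (w ∘ t))
    where
    sortedShelling : Σ (Permutation′ n) (λ π → ∀ {i j} → w (t i) < w (t j) → π ⟨$⟩ˡ i Fin.< π ⟨$⟩ˡ j) →
                     Shellable F
    sortedShelling (π , sorted) = π , levelsBounded⇒shelling bounded
      where
      open Shelling π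
      bounded : ∀ j {y} → y ∈ F (π ⟨$⟩ʳ j) → level y Fin.≤ j
      bounded j {y} y∈F with y Fin.≟ introducedAt j
      ... | yes refl = ℕ.≤-reflexive (cong toℕ (level∘introducedAt j))
      ... | no  y≢   = ℕ.<⇒≤ (subst (level y Fin.<_) (inverseˡ π) (sorted
                         (subst (λ x → w x < w (introducedAt j)) (sym (t∘t⁻¹ y)) (maximal (π ⟨$⟩ʳ j) y∈F y≢))))

  module Insertion (π : Permutation′ n) (maximal : TransversalMaximal (toℕ ∘ Shelling.level π))
                   (f : Fin n → ℕ) (f-configuration : IsConfiguration F t f) where

    open Shelling π

    Introduced : ℕ → Fin n → Set
    Introduced k x = toℕ (level x) < k

    record PartialRealisation (k : ℕ) (v : Fin n → ℕ) : Set where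
      field
        bounded   : ∀ {x} → Introduced k x → v x < k
        injective : ∀ {x y} → Introduced k x → Introduced k y → v x ≡ v y → x ≡ y
        realised  : ∀ i → Introduced k (t i) → suc ∣ lowerSet v (v (t i)) (F i - t i) ∣ ≡ f (t i)

    -- The transversal element e of the k-th member F i gets a value c below which lie exactly
    -- f e ∸ 1 of the (earlier) other elements of F i; the old values from c on move up by one.
    module Extension {k} (k<n : k < n) {v} (r : PartialRealisation k v) where
      open PartialRealisation r

      others-earlier : ∀ {i d} → d ∈ F i - t i → toℕ (level d) < toℕ (level (t i))
      others-earlier d∈ = maximal _ (x∈p-y⇒x∈p d∈) (x∈p-y⇒x≢y d∈)

      j i e : Fin n
      j = fromℕ< k<n
      i = π ⟨$⟩ʳ j
      e = t i

      D : Subset n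
      D = F i - e

      level-e : toℕ (level e) ≡ k
      level-e = trans (cong toℕ (level∘introducedAt j)) (toℕ-fromℕ< k<n)

      earlier⇒≢e : ∀ {x} → Introduced k x → x ≢ e
      earlier⇒≢e lt refl = ℕ.<-irrefl level-e lt

      introduced-before : ∀ {x} → Introduced (suc k) x → x ≢ e → Introduced k x
      introduced-before {x} lt x≢e = ℕ.≤∧≢⇒< (ℕ.s≤s⁻¹ lt) λ eq →
        x≢e (level-injective (toℕ-injective (trans eq (sym level-e))))

      D-earlier : ∀ {d} → d ∈ D → Introduced k d
      D-earlier d∈ = subst (toℕ (level _) <_) level-e (others-earlier d∈)

      target≤∣lowerSet∣ : f e ∸ 1 ≤ ∣ lowerSet v k D ∣
      target≤∣lowerSet∣ = begin
        f e ∸ 1            ≤⟨ ℕ.∸-monoˡ-≤ 1 (proj₂ f-configuration i) ⟩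
        ∣ F i ∣ ∸ 1        ≡⟨ cong (_∸ 1) (∣p∣≡1+∣p-x∣ (proj₂ t-transversal i)) ⟩
        ∣ D ∣              ≡⟨ ∣lowerSet∣-all (bounded ∘ D-earlier) ⟨
        ∣ lowerSet v k D ∣ ∎
        where open ℕ.≤-Reasoning

      threshold : ∃ λ c → c ≤ k × ∣ lowerSet v c D ∣ ≡ f e ∸ 1
      threshold = discrete-ivt (λ c → ∣ lowerSet v c D ∣)
        (∣lowerSet∣-suc≤ λ x∈ y∈ → injective (D-earlier x∈) (D-earlier y∈))
        k (ℕ.≤-trans (ℕ.≤-reflexive (∣lowerSet∣-zero v D)) z≤n) target≤∣lowerSet∣

      c : ℕ
      c = proj₁ threshold

      v′ : Fin n → ℕ
      v′ = insertAt e c v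

      v′-new : v′ e ≡ c
      v′-new = insertAt-≡ {e = e} {c} {v}

      v′-old : ∀ {x} → x ≢ e → v′ x ≡ shiftFrom c (v x)
      v′-old = insertAt-≢ {e = e} {c} {v}

      bounded′ : ∀ {x} → Introduced (suc k) x → v′ x < suc k
      bounded′ {x} lt = byCases (x ≟ e)
        where
        byCases : Dec (x ≡ e) → v′ x < suc k
        byCases (yes refl) = subst (_< suc k) (sym v′-new) (s≤s (proj₁ (proj₂ threshold)))
        byCases (no  x≢e)  = subst (_< suc k) (sym (v′-old x≢e))
          (ℕ.≤-<-trans (shiftFrom≤1+ c (v x)) (s≤s (bounded (introduced-before lt x≢e))))

      injective′ : ∀ {x y} → Introduced (suc k) x → Introduced (suc k) y → v′ x ≡ v′ y → x ≡ y
      injective′ {x} {y} ltx lty eq = byCases (x ≟ e) (y ≟ e)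
        where
        byCases : Dec (x ≡ e) → Dec (y ≡ e) → x ≡ y
        byCases (yes refl) (yes refl) = refl
        byCases (yes refl) (no  y≢e)  =
          contradiction (trans (sym (v′-old y≢e)) (trans (sym eq) v′-new)) (shiftFrom≢c c (v y))
        byCases (no  x≢e)  (yes refl) =
          contradiction (trans (sym (v′-old x≢e)) (trans eq v′-new)) (shiftFrom≢c c (v x))
        byCases (no  x≢e)  (no  y≢e)  = injective (introduced-before ltx x≢e) (introduced-before lty y≢e)
          (shiftFrom-injective c (trans (sym (v′-old x≢e)) (trans eq (v′-old y≢e))))

      realised-old : ∀ i′ → Introduced k (t i′) →
                     suc ∣ lowerSet v′ (v′ (t i′)) (F i′ - t i′) ∣ ≡ f (t i′)
      realised-old i′ lt = trans (cong suc (∣lowerSet∣-cong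
          (λ d∈ → shiftFrom-cancel-< c ∘ subst₂ _<_ (v′-old (d≢e d∈)) (v′-old ti′≢e))
          (λ d∈ → subst₂ _<_ (sym (v′-old (d≢e d∈))) (sym (v′-old ti′≢e)) ∘ shiftFrom-mono-< c)))
        (realised i′ lt)
        where
        ti′≢e = earlier⇒≢e lt
        d≢e : ∀ {d} → d ∈ F i′ - t i′ → d ≢ e
        d≢e d∈ = earlier⇒≢e (ℕ.<-trans (others-earlier d∈) lt)

      realised-new : suc ∣ lowerSet v′ (v′ e) D ∣ ≡ f e
      realised-new = begin
        suc ∣ lowerSet v′ (v′ e) D ∣ ≡⟨ cong suc (∣lowerSet∣-cong
          (λ d∈ → shiftFrom<c⇒<c ∘ subst₂ _<_ (v′-old (x∈p-y⇒x≢y d∈)) v′-new)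
          (λ d∈ → subst₂ _<_ (sym (v′-old (x∈p-y⇒x≢y d∈))) (sym v′-new) ∘ <c⇒shiftFrom<c)) ⟩
        suc ∣ lowerSet v c D ∣       ≡⟨ cong suc (proj₂ (proj₂ threshold)) ⟩
        suc (f e ∸ 1)                ≡⟨ ℕ.suc-pred (f e) ⦃ ℕ.>-nonZero (proj₁ f-configuration e) ⦄ ⟩
        f e                          ∎
        where open ≡-Reasoning

      realised′ : ∀ i′ → Introduced (suc k) (t i′) →
                  suc ∣ lowerSet v′ (v′ (t i′)) (F i′ - t i′) ∣ ≡ f (t i′)
      realised′ i′ lt = byCases (t i′ ≟ e)
        where
        byCases : Dec (t i′ ≡ e) → suc ∣ lowerSet v′ (v′ (t i′)) (F i′ - t i′) ∣ ≡ f (t i′)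
        byCases (yes ti′≡e) = subst (λ i′ → suc ∣ lowerSet v′ (v′ (t i′)) (F i′ - t i′) ∣ ≡ f (t i′))
                                (sym (proj₁ t-transversal ti′≡e)) realised-new
        byCases (no  ti′≢e) = realised-old i′ (introduced-before lt ti′≢e)

      extended : PartialRealisation (suc k) v′
      extended = record { bounded = bounded′ ; injective = injective′ ; realised = realised′ }

    realisation : ∀ k → k ≤ n → ∃ (PartialRealisation k)
    realisation zero    _   = (λ _ → 0) , record { bounded = λ () ; injective = λ () ; realised = λ _ () }
    realisation (suc k) k<n = _ , Extension.extended k<n (proj₂ (realisation k (ℕ.<⇒≤ k<n)))

    bijectiveRealisation : Σ (Fin n → Fin n) λ σ → Surjective _≡_ _≡_ σ × Satisfies F t f σ
    bijectiveRealisation = σ , σ-surjective , σ-satisfies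
      where
      V : Fin n → ℕ
      V = proj₁ (realisation n ≤-refl)
      open PartialRealisation (proj₂ (realisation n ≤-refl))

      V<n : ∀ x → V x < n
      V<n x = bounded (toℕ<n (level x))

      σ : Fin n → Fin n
      σ x = fromℕ< (V<n x)

      toℕ∘σ : ∀ x → toℕ (σ x) ≡ V x
      toℕ∘σ x = toℕ-fromℕ< (V<n x)

      σ-injective : Injective _≡_ _≡_ σ
      σ-injective {x} {y} eq = injective (toℕ<n (level x)) (toℕ<n (level y))
        (trans (sym (toℕ∘σ x)) (trans (cong toℕ eq) (toℕ∘σ y)))

      σ-surjective : Surjective _≡_ _≡_ σ
      σ-surjective y = let x , σx≡y = injective⇒surjective σ-injective y in x , λ { refl → σx≡y }

      σ-satisfies : Satisfies F t f σ
      σ-satisfies i = ∈-image⁺ σ (F i) ti∈Fi , (begin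
        suc ∣ below (σ (t i)) (image σ (F i)) ∣
          ≡⟨ cong suc (∣below∣≡∣lowerSet∣ σ ti∈Fi λ _ _ → σ-injective) ⟩
        suc ∣ lowerSet (toℕ ∘ σ) (toℕ (σ (t i))) (F i - t i) ∣
          ≡⟨ cong suc (∣lowerSet∣-cong {D = F i - t i}
               (λ {d} _ → subst₂ _<_ (toℕ∘σ d) (toℕ∘σ (t i)))
               (λ {d} _ → subst₂ _<_ (sym (toℕ∘σ d)) (sym (toℕ∘σ (t i))))) ⟩
        suc ∣ lowerSet V (V (t i)) (F i - t i) ∣
          ≡⟨ realised i (toℕ<n (level (t i))) ⟩
        f (t i)
          ∎)
        where
        open ≡-Reasoning
        ti∈Fi : t i ∈ F i
        ti∈Fi = proj₂ t-transversal i

  Realisable : ℕ → Set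
  Realisable m = (f : Fin n → ℕ) → IsConfiguration F t f →
                 Σ (Fin n → Fin m) λ σ → Surjective _≡_ _≡_ σ × Satisfies F t f σ

  sizeConfiguration : IsConfiguration F t (λ y → ∣ F (t⁻¹ y) ∣)
  sizeConfiguration = (λ y → ≤-trans (s≤s z≤n) (ℕ.≤-reflexive (sym (∣p∣≡1+∣p-x∣ (∈-F∘t⁻¹ y)))))
                    , λ i → ℕ.≤-reflexive (cong (∣_∣ ∘ F) (t⁻¹∘t i))

  realisable⇒shellable : Realisable m → Shellable F
  realisable⇒shellable realisable =
    let σ , _ , satisfies = realisable _ sizeConfiguration in
    transversalMaximal⇒shellable {w = toℕ ∘ σ} λ i → ∣A∣thSmallest⇒maximum σ (proj₂ t-transversal i)
      (subst (λ k → IsKthSmallest k (σ (t i)) (image σ (F i))) (cong (∣_∣ ∘ F) (t⁻¹∘t i)) (satisfies i))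

  compressSatisfying : ∀ {f} (σ : Fin n → Fin n) → Surjective _≡_ _≡_ σ → Satisfies F t f σ →
                       n ⊓ (n ∸ ∣ uniqueElems F ∣ + 1) ≤ m → m ≤ n →
                       Σ (Fin n → Fin m) λ σ′ → Surjective _≡_ _≡_ σ′ × Satisfies F t f σ′
  compressSatisfying {m} {f} σ σ-surjective σ-satisfies lower upper = compose (compression NonUnique bound upper)
    where
    NonUnique : Subset n
    NonUnique = image σ (∁ (uniqueElems F))

    bound : n ⊓ suc ∣ NonUnique ∣ ≤ m
    bound = ≤-trans
      (ℕ.⊓-monoʳ-≤ n (s≤s (≤-trans (∣image∣≤∣p∣ σ _) (ℕ.≤-reflexive (∣∁p∣≡n∸∣p∣ (uniqueElems F))))))
      (subst (λ k → n ⊓ k ≤ m) (ℕ.+-comm (n ∸ ∣ uniqueElems F ∣) 1) lower)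

    non-unique : ∀ {i y} → y ∈ F i → y ≢ t i → σ y ∈ NonUnique
    non-unique y∈ y≢ = ∈-image⁺ σ _ (x∉p⇒x∈∁p (non-transversal⇒∉uniqueElems y∈ y≢))

    compose : Σ (Fin n → Fin m) (λ g → Surjective _≡_ _≡_ g × (∀ {x y} → x Fin.≤ y → g x Fin.≤ g y) ×
                                       (∀ {x y} → x ∈ NonUnique → x Fin.< y → g x Fin.< g y)) →
              Σ (Fin n → Fin m) λ σ′ → Surjective _≡_ _≡_ σ′ × Satisfies F t f σ′
    compose (g , g-surjective , g-mono , g-strict) =
      g ∘ σ , Compose.surjective _≡_ _≡_ _≡_ σ-surjective g-surjective ,
      λ i → kthSmallest-∘ σ (proj₂ t-transversal i) g g-mono
              (λ y∈ y≢ → g-strict (non-unique y∈ y≢)) (σ-satisfies i)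

  shellable⇒realisable : Shellable F → n ⊓ (n ∸ ∣ uniqueElems F ∣ + 1) ≤ m → m ≤ n → Realisable m
  shellable⇒realisable (π , shelling) lower upper f f-configuration =
    let σ , σ-surjective , σ-satisfies =
          Insertion.bijectiveRealisation π (Shelling.shelling⇒transversalMaximal π shelling) f f-configuration
    in compressSatisfying {f = f} σ σ-surjective σ-satisfies lower upper

theorem3p23 : (n : ℕ) (F : Family n) → MarriageCondition F →
    (t : Fin n → Fin n) → IsTransversal F t →
    (m : ℕ) → n ⊓ (n ∸ ∣ uniqueElems F ∣ + 1) ≤ m → m ≤ n →
    Shellable F ⇔
      ((f : Fin n → ℕ) → IsConfiguration F t f →
        Σ (Fin n → Fin m) λ σ → Surjective _≡_ _≡_ σ × Satisfies F t f σ)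
theorem3p23 n F _ t t-transversal m lower upper =
  mk⇔ (λ shellable → shellable⇒realisable shellable lower upper) realisable⇒shellable
  where open Transversal F t t-transversal
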